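{- Let $\mathcal{D}=\langle A_0;S_0;T_0;\theta_0\rangle\Longrightarrow^{*}\langle\emptyset;S_n;T_n;\theta_n\rangle$ be an $\textsc{AUnif}$ derivation to a final configuration, and let $\sigma_{\mathcal{D}}=\sigma_{S_n\cup T_n}$ and $\rho_{\mathcal{D}}=\rho_{S_n\cup T_n}$. Then for every $s\triangleq_x t\in A_0\cup S_0\cup T_0$ we have $x\theta_n\in\mathcal{G}_{\mathtt{Abs}}(s,t)$, with $x\theta_n\sigma_{\mathcal{D}}\approx_{\mathtt{Abs}}s$ and $x\theta_n\rho_{\mathcal{D}}\approx_{\mathtt{Abs}}t$.
   Context: Terms are built over variables $\mathcal{V}$ and function symbols $\mathcal{F}$ containing a special constant $\star$ (wild card); $head(x)=x$, $head(f(t_1,\dots,t_n))=f$. Substitutions are postfix; $\mathit{Dom}(\sigma)=\{x\mid x\sigma\neq x\}$; $\mathit{Rvar}(\sigma)$ is the set of variables in its range. An absorption theory $\mathtt{Abs}$ is a finite union of axiom sets $\{f(x,\varepsilon_f)\approx\varepsilon_f, f(\varepsilon_f,x)\approx\varepsilon_f\}$ for pairwise distinct binary $f$; $f,\varepsilon_f$ are related absorption symbols; $\approx_{\mathtt{Abs}}$ is the induced equality. $r\preceq_{\mathtt{Abs}}s$ iff $r\sigma\approx_{\mathtt{Abs}}s$ for some $\sigma$; $\mathcal{G}_{\mathtt{Abs}}(s,t)=\{r\mid r\preceq_{\mathtt{Abs}}s,\ r\preceq_{\mathtt{Abs}}t\}$. A term is in $\mathtt{Abs}$-normal form if no $\varepsilon_f$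 occurs as an argument of $f$. An AUE is $s\triangleq_x t$ with label $x$; a set of AUEs is valid if labels are pairwise distinct; an AUE is wild if a side is $\star$; solved if $head(s)\neq head(t)$, they are not related absorption symbols, and it is not wild. A configuration $\langle A;S;T;\theta\rangle$: $A$ valid set of AUEs, $S$ valid set of solved AUEs, $T$ valid set of wild AUEs, $\theta$ a substitution, all terms in $\mathtt{Abs}$-normal form, $labels(A),labels(S),labels(T),\mathit{Dom}(\theta)$ pairwise disjoint, $\mathit{Rvar}(\theta)=labels(A)\cup labels(S)\cup labels(T)$. Rules of $\textsc{AUnif}$ ($\uplus$ disjoint union; $y_i$ fresh; $f$ in Exp rules an absorption symbol): (Dec) $\langle\{f(s_1,\dots,s_n)\triangleq_x f(t_1,\dots,t_n)\}\uplus A;S;T;\theta\rangle\Longrightarrow\langle\{s_i\triangleq_{y_i}t_i\}_{i=1}^n\cup A;S;T;\theta\{x\mapsto f(y_1,\dots,y_n)\}\rangle$, $n\ge0$. (Sol) $\langle\{s\triangleq_x t\}\uplus A;S;T;\theta\rangle\Longrightarrow\langle A;\{s\triangleq_x t\}\cup S;T;\theta\rangle$ if $head(s)\neq head(t)$ and they are not related absorption symbols. (ExpLA1) $\langle\{\varepsilon_f\triangleq_x f(t_1,t_2)\}\uplus A;S;T;\theta\rangle\Longrightarrow\langle\{\varepsilon_f\triangleq_{y_1}t_1\}\cup A;S;\{\star\triangleq_{y_2}t_2\}\cup T;\theta\{x\mapsto f(y_1,y_2)\}\rangle$. (ExpLA2) same left side $\Longrightarrow\langle\{\varepsilon_f\triangleq_{y_2}t_2\}\cup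 A;S;\{\star\triangleq_{y_1}t_1\}\cup T;\theta\{x\mapsto f(y_1,y_2)\}\rangle$. (ExpRA1) $\langle\{f(s_1,s_2)\triangleq_x\varepsilon_f\}\uplus A;S;T;\theta\rangle\Longrightarrow\langle\{s_1\triangleq_{y_1}\varepsilon_f\}\cup A;S;\{s_2\triangleq_{y_2}\star\}\cup T;\theta\{x\mapsto f(y_1,y_2)\}\rangle$. (ExpRA2) same left side $\Longrightarrow\langle\{s_2\triangleq_{y_2}\varepsilon_f\}\cup A;S;\{s_1\triangleq_{y_1}\star\}\cup T;\theta\{x\mapsto f(y_1,y_2)\}\rangle$. (Mer) $\langle\emptyset;\{s\triangleq_x t,s\triangleq_y t\}\cup S;T;\theta\rangle\Longrightarrow\langle\emptyset;\{s\triangleq_y t\}\cup S;T;\theta\{x\mapsto y\}\rangle$. A final configuration is one reached by a finite derivation to which no rule applies. For a valid set $W$ of AUEs, $\sigma_W=\{y\mapsto s\mid s\triangleq_y t\in W\}$ and $\rho_W=\{y\mapsto t\mid s\triangleq_y t\in W\}$. In the equalities, the wild card $\star$ is treated as an ordinary constant occurring under an absorption symbol next to $\varepsilon_f$ where it is absorbed. -}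

module Defs where

open import Data.Nat using (ℕ; _≟_)
open import Data.List using (List; []; _∷_; _++_; map; length)
open import Data.List.Membership.Propositional using (_∈_; _∉_)
open import Data.List.Relation.Unary.All using (All)
open import Data.List.Relation.Unary.Any using (Any)
open import Data.List.Relation.Unary.Unique.Propositional using (Unique)
open import Data.List.Relation.Binary.Pointwise using (Pointwise)
open import Data.List.Relation.Binary.Permutation.Propositional using (_↭_)
open import Data.List.Relation.Binary.Disjoint.Propositional using (Disjoint)
open import Data.Product using (Σ; ∃; ∃-syntax; _×_; _,_)
open import Data.Sum using (_⊎_)
open import Relation.Nullary using (¬_; yes; no)
open import Relation.Binary.PropositionalEquality using (_≡_; _≢_)

-- Ranked signature F, containing the special constant ⋆ (wild card).
-- Variables V are natural numbers (an infinite supply of fresh ones).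

record Signature : Set₁ where
  field
    Fun    : Set
    arity  : Fun → ℕ
    ⋆      : Fun
    ⋆-const : arity ⋆ ≡ 0

V : Set
V = ℕ

-- It stands for the
-- union of the axiom sets {f(x,ε_f) ≈ ε_f , f(ε_f,x) ≈ ε_f}.

record AbsTheory (Sg : Signature) : Set where
  open Signature Sg
  field
    pairs     : List (Fun × Fun)
    binary    : ∀ {f e} → (f , e) ∈ pairs → arity f ≡ 2
    constant  : ∀ {f e} → (f , e) ∈ pairs → arity e ≡ 0
    distinctF : Unique (map (λ p → Data.Product.proj₁ p) pairs)

module AUnif (Sg : Signature) (Ab : AbsTheory Sg) where
  open Signature Sg
  open AbsTheory Ab

  data Term : Set where
    var : V → Term
    app : Fun → List Term → Term

  data WF : Term → Set where
    wf-var : ∀ {x} → WF (var x)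
    wf-app : ∀ {f ts} → length ts ≡ arity f → All WF ts → WF (app f ts)

  star : Term
  star = app ⋆ []

  cst : Fun → Term
  cst e = app e []

  data Head : Set where
    hvar : V → Head
    hfun : Fun → Head

  head : Term → Head
  head (var x)   = hvar x
  head (app f _) = hfun f

  data _occurs-in_ (x : V) : Term → Set where
    here  : x occurs-in var x
    under : ∀ {f ts} → Any (x occurs-in_) ts → x occurs-in app f ts

  Subst : Set
  Subst = V → Term

  mutual
    _[_] : Term → Subst → Term
    var x    [ σ ] = σ x
    app f ts [ σ ] = app f (ts [ σ ]*)

    _[_]* : List Term → Subst → List Term
    []       [ σ ]* = []
    (t ∷ ts) [ σ ]* = (t [ σ ]) ∷ (ts [ σ ]*)

  _⨾_ : Subst → Subst → Subst
  (θ ⨾ η) v = θ v [ η ]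

  ⟦_↦_⟧ : V → Term → Subst
  ⟦ x ↦ u ⟧ v with v ≟ x
  ... | yes _ = u
  ... | no  _ = var v

  InDom : Subst → V → Set
  InDom σ x = σ x ≢ var x

  InRvar : Subst → V → Set
  InRvar σ y = ∃[ x ] (InDom σ x × y occurs-in σ x)

  FiniteDom : Subst → Set
  FiniteDom σ = ∃[ L ] (∀ x → InDom σ x → x ∈ L)

  data _≈_ : Term → Term → Set where
    ≈-refl  : ∀ {t} → t ≈ t
    ≈-sym   : ∀ {s t} → s ≈ t → t ≈ s
    ≈-trans : ∀ {r s t} → r ≈ s → s ≈ t → r ≈ t
    ≈-cong  : ∀ {f ss ts} → Pointwise _≈_ ss ts → app f ss ≈ app f ts
    ≈-absR  : ∀ {f e} → (f , e) ∈ pairs → ∀ t → app f (t ∷ cst e ∷ []) ≈ cst e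
    ≈-absL  : ∀ {f e} → (f , e) ∈ pairs → ∀ t → app f (cst e ∷ t ∷ []) ≈ cst e

  _⪯_ : Term → Term → Set
  r ⪯ s = ∃[ σ ] ((r [ σ ]) ≈ s)

  InG : Term → Term → Term → Set
  InG r s t = r ⪯ s × r ⪯ t

  data NF : Term → Set where
    nf-var : ∀ {x} → NF (var x)
    nf-app : ∀ {f ts} → All NF ts → (∀ {e} → (f , e) ∈ pairs → cst e ∉ ts) →
             NF (app f ts)

  Related : Head → Head → Set
  Related h h' = ∃[ f ] ∃[ e ] ((f , e) ∈ pairs ×
                   ((h ≡ hfun f × h' ≡ hfun e) ⊎ (h ≡ hfun e × h' ≡ hfun f)))

  record AUE : Set where
    constructor _≜⟨_⟩_
    field
      lhs : Term
      lbl : V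
      rhs : Term
  open AUE public

  labels : List AUE → List V
  labels = map lbl

  Valid : List AUE → Set
  Valid W = Unique (labels W)

  Wild : AUE → Set
  Wild e = lhs e ≡ star ⊎ rhs e ≡ star

  Solved : AUE → Set
  Solved e = head (lhs e) ≢ head (rhs e) × ¬ Related (head (lhs e)) (head (rhs e)) × ¬ Wild e

  σ_ : List AUE → Subst
  σ_ [] y = var y
  σ_ (e ∷ W) y with y ≟ lbl e
  ... | yes _ = lhs e
  ... | no  _ = σ_ W y

  ρ_ : List AUE → Subst
  ρ_ [] y = var y
  ρ_ (e ∷ W) y with y ≟ lbl e
  ... | yes _ = rhs e
  ... | no  _ = ρ_ W y

  -- Configurations ⟨A;S;T;θ⟩ (sets of AUEs represented by lists;
  -- rules pick elements up to permutation)

  record Config : Set where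
    constructor ⟨_,_,_,_⟩
    field
      A S T : List AUE
      θ     : Subst
  open Config public

  allAUEs : Config → List AUE
  allAUEs c = A c ++ S c ++ T c

  TermsOK : (Term → Set) → List AUE → Set
  TermsOK P W = All (λ e → P (lhs e) × P (rhs e)) W

  IsConfig : Config → Set
  IsConfig c =
    Valid (A c) × (Valid (S c) × All Solved (S c)) × (Valid (T c) × All Wild (T c)) ×
    FiniteDom (θ c) ×
    TermsOK WF (allAUEs c) × TermsOK NF (allAUEs c) ×
    Disjoint (labels (A c)) (labels (S c)) ×
    Disjoint (labels (A c)) (labels (T c)) ×
    Disjoint (labels (S c)) (labels (T c)) ×
    (∀ x → x ∈ labels (allAUEs c) → ¬ InDom (θ c) x) ×
    (∀ y → InRvar (θ c) y → y ∈ labels (allAUEs c)) ×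
    (∀ y → y ∈ labels (allAUEs c) → InRvar (θ c) y)

  Fresh : Config → V → Set
  Fresh c y =
    y ∉ labels (allAUEs c) × ¬ InDom (θ c) y × ¬ InRvar (θ c) y ×
    All (λ e → ¬ y occurs-in lhs e × ¬ y occurs-in rhs e) (allAUEs c)

  FreshVars : Config → List V → Set
  FreshVars c ys = Unique ys × All (Fresh c) ys

  zipAUE : List Term → List V → List Term → List AUE
  zipAUE (s ∷ ss) (y ∷ ys) (t ∷ ts) = (s ≜⟨ y ⟩ t) ∷ zipAUE ss ys ts
  zipAUE _ _ _ = []

  data Rule : Config → Config → Set where
    Dec : ∀ {A A₁ S T θ f ss ts x ys} →
          A ↭ ((app f ss ≜⟨ x ⟩ app f ts) ∷ A₁) →
          length ts ≡ length ss → length ys ≡ length ss →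
          FreshVars ⟨ A , S , T , θ ⟩ ys →
          Rule ⟨ A , S , T , θ ⟩
               ⟨ zipAUE ss ys ts ++ A₁ , S , T , θ ⨾ ⟦ x ↦ app f (map var ys) ⟧ ⟩
    Sol : ∀ {A A₁ S T θ s x t} →
          A ↭ ((s ≜⟨ x ⟩ t) ∷ A₁) →
          head s ≢ head t → ¬ Related (head s) (head t) →
          Rule ⟨ A , S , T , θ ⟩ ⟨ A₁ , (s ≜⟨ x ⟩ t) ∷ S , T , θ ⟩
    ExpLA1 : ∀ {A A₁ S T θ f e t₁ t₂ x y₁ y₂} → (f , e) ∈ pairs →
          A ↭ ((cst e ≜⟨ x ⟩ app f (t₁ ∷ t₂ ∷ [])) ∷ A₁) →
          FreshVars ⟨ A , S , T , θ ⟩ (y₁ ∷ y₂ ∷ []) →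
          Rule ⟨ A , S , T , θ ⟩
               ⟨ (cst e ≜⟨ y₁ ⟩ t₁) ∷ A₁ , S , (star ≜⟨ y₂ ⟩ t₂) ∷ T ,
                 θ ⨾ ⟦ x ↦ app f (var y₁ ∷ var y₂ ∷ []) ⟧ ⟩
    ExpLA2 : ∀ {A A₁ S T θ f e t₁ t₂ x y₁ y₂} → (f , e) ∈ pairs →
          A ↭ ((cst e ≜⟨ x ⟩ app f (t₁ ∷ t₂ ∷ [])) ∷ A₁) →
          FreshVars ⟨ A , S , T , θ ⟩ (y₁ ∷ y₂ ∷ []) →
          Rule ⟨ A , S , T , θ ⟩
               ⟨ (cst e ≜⟨ y₂ ⟩ t₂) ∷ A₁ , S , (star ≜⟨ y₁ ⟩ t₁) ∷ T ,
                 θ ⨾ ⟦ x ↦ app f (var y₁ ∷ var y₂ ∷ []) ⟧ ⟩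
    ExpRA1 : ∀ {A A₁ S T θ f e s₁ s₂ x y₁ y₂} → (f , e) ∈ pairs →
          A ↭ ((app f (s₁ ∷ s₂ ∷ []) ≜⟨ x ⟩ cst e) ∷ A₁) →
          FreshVars ⟨ A , S , T , θ ⟩ (y₁ ∷ y₂ ∷ []) →
          Rule ⟨ A , S , T , θ ⟩
               ⟨ (s₁ ≜⟨ y₁ ⟩ cst e) ∷ A₁ , S , (s₂ ≜⟨ y₂ ⟩ star) ∷ T ,
                 θ ⨾ ⟦ x ↦ app f (var y₁ ∷ var y₂ ∷ []) ⟧ ⟩
    ExpRA2 : ∀ {A A₁ S T θ f e s₁ s₂ x y₁ y₂} → (f , e) ∈ pairs →
          A ↭ ((app f (s₁ ∷ s₂ ∷ []) ≜⟨ x ⟩ cst e) ∷ A₁) →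
          FreshVars ⟨ A , S , T , θ ⟩ (y₁ ∷ y₂ ∷ []) →
          Rule ⟨ A , S , T , θ ⟩
               ⟨ (s₂ ≜⟨ y₂ ⟩ cst e) ∷ A₁ , S , (s₁ ≜⟨ y₁ ⟩ star) ∷ T ,
                 θ ⨾ ⟦ x ↦ app f (var y₁ ∷ var y₂ ∷ []) ⟧ ⟩
    Mer : ∀ {S S₁ T θ s t x y} →
          S ↭ ((s ≜⟨ x ⟩ t) ∷ (s ≜⟨ y ⟩ t) ∷ S₁) →
          Rule ⟨ [] , S , T , θ ⟩ ⟨ [] , (s ≜⟨ y ⟩ t) ∷ S₁ , T , θ ⨾ ⟦ x ↦ var y ⟧ ⟩

  _⟹_ : Config → Config → Set
  c ⟹ c' = IsConfig c × IsConfig c' × Rule c c'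

  data _⟹*_ : Config → Config → Set where
    done : ∀ {c} → c ⟹* c
    step : ∀ {c c' c''} → c ⟹ c' → c' ⟹* c'' → c ⟹* c''

  Final : Config → Set
  Final c = ¬ (∃[ c' ] Rule c c')

-- Read the derivation backwards.  For every configuration c on it there is a
-- substitution δ with θₙ = θ_c δ such that, for each equation s ≜_y t of c,
-- y δ σ_D ≈ s and y δ ρ_D ≈ t.  At the final configuration δ is the identity,
-- by the definition of σ_D and ρ_D.  A rule binding x ↦ f(y₁,…,yₙ) preserves
-- the invariant when δ is extended by the same binding: the generalisations of
-- the new equations recombine under f into a generalisation of the selected
-- equation, where in the expansion rules the side f(ε_f, ⋆) or f(⋆, ε_f)
-- collapses to ε_f by absorption.
module Submission where

open import Defs
open import Data.Nat using (_≟_)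
open import Data.Nat.Properties using (suc-injective)
open import Data.List using (List; []; _∷_; _++_; map; length)
open import Data.List.Membership.Propositional using (_∈_)
open import Data.List.Membership.Propositional.Properties using (∈-++⁻; ∈-++⁺ˡ; ∈-++⁺ʳ; ∈-map⁺)
open import Data.List.Relation.Unary.Any using (here; there)
open import Data.List.Relation.Unary.All as All using ()
open import Data.List.Relation.Unary.AllPairs using (_∷_)
open import Data.List.Relation.Unary.Unique.Propositional using (Unique)
import Data.List.Relation.Unary.Unique.Propositional.Properties as Unique
open import Data.List.Relation.Binary.Pointwise using (Pointwise; []; _∷_)
open import Data.List.Relation.Binary.Permutation.Propositional using (_↭_; ↭-sym)
open import Data.List.Relation.Binary.Permutation.Propositional.Properties using (shift)
open import Data.List.Relation.Binary.Subset.Propositional using (_⊆_)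
open import Data.List.Relation.Binary.Subset.Propositional.Properties
  using (⊆-refl; ⊆-reflexive-↭; xs⊆x∷xs; xs⊆ys++xs; ++⁺ˡ; ++⁺ʳ)
open import Data.List.Relation.Binary.Disjoint.Propositional using (Disjoint)
open import Data.List.Properties using (map-++)
open import Data.Product using (∃-syntax; _×_; _,_)
open import Data.Sum using ([_,_])
open import Data.Empty using (⊥-elim)
open import Function using (_∘_)
open import Relation.Nullary using (¬_; yes; no)
open import Relation.Binary.PropositionalEquality
  using (_≡_; _≗_; refl; sym; trans; cong; cong₂; subst)

module Properties (Sg : Signature) (Ab : AbsTheory Sg) where
  open AUnif Sg Ab

  mutual
    []-identity : ∀ t → t [ var ] ≡ t
    []-identity (var x)    = refl
    []-identity (app f ts) = cong (app f) ([]*-identity ts)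

    []*-identity : ∀ ts → ts [ var ]* ≡ ts
    []*-identity []       = refl
    []*-identity (t ∷ ts) = cong₂ _∷_ ([]-identity t) ([]*-identity ts)

  mutual
    []-⨾ : ∀ t σ τ → t [ σ ] [ τ ] ≡ t [ σ ⨾ τ ]
    []-⨾ (var x)    σ τ = refl
    []-⨾ (app f ts) σ τ = cong (app f) ([]*-⨾ ts σ τ)

    []*-⨾ : ∀ ts σ τ → ts [ σ ]* [ τ ]* ≡ ts [ σ ⨾ τ ]*
    []*-⨾ []       σ τ = refl
    []*-⨾ (t ∷ ts) σ τ = cong₂ _∷_ ([]-⨾ t σ τ) ([]*-⨾ ts σ τ)

  lbl-injective : ∀ {W e e′} → Valid W → e ∈ W → e′ ∈ W → lbl e ≡ lbl e′ → e ≡ e′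
  lbl-injective (_ ∷ _)  (here refl) (here refl) _  = refl
  lbl-injective (u ∷ _)  (here refl) (there e′∈) eq = ⊥-elim (All.lookup u (∈-map⁺ lbl e′∈) eq)
  lbl-injective (u ∷ _)  (there e∈)  (here refl) eq = ⊥-elim (All.lookup u (∈-map⁺ lbl e∈) (sym eq))
  lbl-injective (_ ∷ us) (there e∈)  (there e′∈) eq = lbl-injective us e∈ e′∈ eq

  σ-lbl : ∀ {W e} → Valid W → e ∈ W → (σ W) (lbl e) ≡ lhs e
  σ-lbl {a ∷ W} {e} (u ∷ us) e∈ with lbl e ≟ lbl a | e∈
  ... | yes _  | here refl = refl
  ... | yes eq | there e∈W = ⊥-elim (All.lookup u (∈-map⁺ lbl e∈W) (sym eq))
  ... | no  ne | here refl = ⊥-elim (ne refl)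
  ... | no  _  | there e∈W = σ-lbl us e∈W

  ρ-lbl : ∀ {W e} → Valid W → e ∈ W → (ρ W) (lbl e) ≡ rhs e
  ρ-lbl {a ∷ W} {e} (u ∷ us) e∈ with lbl e ≟ lbl a | e∈
  ... | yes _  | here refl = refl
  ... | yes eq | there e∈W = ⊥-elim (All.lookup u (∈-map⁺ lbl e∈W) (sym eq))
  ... | no  ne | here refl = ⊥-elim (ne refl)
  ... | no  _  | there e∈W = ρ-lbl us e∈W

  Disjoint-++ : ∀ {xs ys zs : List V} → Disjoint xs ys → Disjoint xs zs → Disjoint xs (ys ++ zs)
  Disjoint-++ {ys = ys} xs#ys xs#zs (v∈xs , v∈ys++zs) =
    [ (λ v∈ys → xs#ys (v∈xs , v∈ys)) , (λ v∈zs → xs#zs (v∈xs , v∈zs)) ]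
      (∈-++⁻ ys v∈ys++zs)

  IsConfig⇒Valid : ∀ c → IsConfig c → Valid (allAUEs c)
  IsConfig⇒Valid ⟨ A , S , T , θ ⟩ (vA , (vS , _) , (vT , _) , _ , _ , _ , dAS , dAT , dST , _) =
    subst Unique (sym (trans (map-++ lbl A (S ++ T)) (cong (labels A ++_) (map-++ lbl S T))))
      (Unique.++⁺ vA (Unique.++⁺ vS vT dST) (Disjoint-++ dAS dAT))

  ¬InDom⇒fixed : ∀ θ x → ¬ InDom θ x → θ x ≡ var x
  ¬InDom⇒fixed θ x x∉Dom with θ x
  ... | app f ts = ⊥-elim (x∉Dom (λ ()))
  ... | var y with y ≟ x
  ...   | yes refl = refl
  ...   | no y≢x   = ⊥-elim (x∉Dom (λ { refl → y≢x refl }))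

  IsConfig⇒θ-fixes-labels : ∀ c → IsConfig c → ∀ {x} → x ∈ labels (allAUEs c) → θ c x ≡ var x
  IsConfig⇒θ-fixes-labels c (_ , _ , _ , _ , _ , _ , _ , _ , _ , labels∉Dom , _) {x} x∈ =
    ¬InDom⇒fixed (θ c) x (labels∉Dom x x∈)

  ⟹*-IsConfig : ∀ {c c′} → IsConfig c → c ⟹* c′ → IsConfig c′
  ⟹*-IsConfig ic done                    = ic
  ⟹*-IsConfig _  (step (_ , ic′ , _) d) = ⟹*-IsConfig ic′ d

  selected-∈ : ∀ {A A₁ : List AUE} {p} (X : List AUE) → A ↭ p ∷ A₁ → p ∈ A ++ X
  selected-∈ X A↭ = ∈-++⁺ˡ (⊆-reflexive-↭ (↭-sym A↭) (here refl))

  selected-⊆ : ∀ {A A₁ : List AUE} {p} (X : List AUE) → A ↭ p ∷ A₁ → A ++ X ⊆ p ∷ A₁ ++ X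
  selected-⊆ X A↭ = ++⁺ˡ X (⊆-reflexive-↭ A↭)

  module Backward (σₙ ρₙ θₙ : Subst) where

    record Generalises (u s t : Term) : Set where
      constructor generalises
      field
        lhs-≈ : (u [ σₙ ]) ≈ s
        rhs-≈ : (u [ ρₙ ]) ≈ t

    GeneralisedBy : Subst → List AUE → Set
    GeneralisedBy δ W = ∀ {e} → e ∈ W → Generalises (δ (lbl e)) (lhs e) (rhs e)

    Invariant : List AUE → Subst → Set
    Invariant W θ = ∃[ δ ] (θₙ ≗ θ ⨾ δ × GeneralisedBy δ W)

    generalises-respˡ : ∀ {u s s′ t} → s ≈ s′ → Generalises u s t → Generalises u s′ t
    generalises-respˡ s≈s′ (generalises uσ≈s uρ≈t) = generalises (≈-trans uσ≈s s≈s′) uρ≈t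

    generalises-respʳ : ∀ {u s t t′} → t ≈ t′ → Generalises u s t → Generalises u s t′
    generalises-respʳ t≈t′ (generalises uσ≈s uρ≈t) = generalises uσ≈s (≈-trans uρ≈t t≈t′)

    generalises-app₂ : ∀ {f u₁ u₂ s₁ s₂ t₁ t₂} →
      Generalises u₁ s₁ t₁ → Generalises u₂ s₂ t₂ →
      Generalises (app f (u₁ ∷ u₂ ∷ [])) (app f (s₁ ∷ s₂ ∷ [])) (app f (t₁ ∷ t₂ ∷ []))
    generalises-app₂ (generalises σ₁ ρ₁) (generalises σ₂ ρ₂) =
      generalises (≈-cong (σ₁ ∷ σ₂ ∷ [])) (≈-cong (ρ₁ ∷ ρ₂ ∷ []))

    generalises-args : ∀ {δ} ss ys ts → length ts ≡ length ss → length ys ≡ length ss →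
      GeneralisedBy δ (zipAUE ss ys ts) →
      Pointwise _≈_ (map var ys [ δ ]* [ σₙ ]*) ss × Pointwise _≈_ (map var ys [ δ ]* [ ρₙ ]*) ts
    generalises-args [] [] [] _ _ _ = [] , []
    generalises-args (s ∷ ss) (y ∷ ys) (t ∷ ts) |ts| |ys| gen =
      let generalises σ₁ ρ₁ = gen (here refl)
          (σ* , ρ*) = generalises-args ss ys ts (suc-injective |ts|) (suc-injective |ys|) (gen ∘ there)
      in (σ₁ ∷ σ*) , (ρ₁ ∷ ρ*)

    invariant-⊆ : ∀ {W W′ θ} → W ⊆ W′ → Invariant W′ θ → Invariant W θ
    invariant-⊆ W⊆W′ (δ , θₙ≗ , gen) = δ , θₙ≗ , gen ∘ W⊆W′

    invariant-bind : ∀ {W W′ R p u θ} → Valid W → p ∈ W → W ⊆ p ∷ R → R ⊆ W′ →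
      (∀ {δ} → GeneralisedBy δ W′ → Generalises (u [ δ ]) (lhs p) (rhs p)) →
      Invariant W′ (θ ⨾ ⟦ lbl p ↦ u ⟧) → Invariant W θ
    invariant-bind {W} {p = p} {u = u} {θ} vW p∈W W⊆p∷R R⊆W′ gen-p (δ′ , θₙ≗ , gen′) =
      ⟦ lbl p ↦ u ⟧ ⨾ δ′ , (λ v → trans (θₙ≗ v) ([]-⨾ (θ v) ⟦ lbl p ↦ u ⟧ δ′)) , gen
      where
        gen : GeneralisedBy (⟦ lbl p ↦ u ⟧ ⨾ δ′) W
        gen {e} e∈W with lbl e ≟ lbl p | W⊆p∷R e∈W
        ... | yes e≡ₗp | _ rewrite lbl-injective vW e∈W p∈W e≡ₗp = gen-p gen′
        ... | no  e≢ₗp | here refl = ⊥-elim (e≢ₗp refl)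
        ... | no  e≢ₗp | there e∈R = gen′ (R⊆W′ e∈R)

    invariant-expand : ∀ {A A₁ S T θ p a b u} → IsConfig ⟨ A , S , T , θ ⟩ → A ↭ p ∷ A₁ →
      (∀ {δ} → Generalises (δ (lbl a)) (lhs a) (rhs a) → Generalises (δ (lbl b)) (lhs b) (rhs b) →
               Generalises (u [ δ ]) (lhs p) (rhs p)) →
      Invariant (allAUEs ⟨ a ∷ A₁ , S , b ∷ T , θ ⨾ ⟦ lbl p ↦ u ⟧ ⟩) (θ ⨾ ⟦ lbl p ↦ u ⟧) →
      Invariant (A ++ S ++ T) θ
    invariant-expand {A₁ = A₁} {S} {T} {θ} {u = u} ic A↭ gen-p =
      invariant-bind {u = u} {θ = θ} (IsConfig⇒Valid _ ic)
        (selected-∈ (S ++ T) A↭) (selected-⊆ (S ++ T) A↭)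
        (xs⊆x∷xs _ _ ∘ ++⁺ʳ A₁ (++⁺ʳ S (xs⊆x∷xs T _)))
        λ gen → gen-p (gen (here refl)) (gen (∈-++⁺ʳ (_ ∷ A₁) (∈-++⁺ʳ S (here refl))))

    invariant-step : ∀ {c c′} → IsConfig c → Rule c c′ →
      Invariant (allAUEs c′) (θ c′) → Invariant (allAUEs c) (θ c)
    invariant-step {⟨ A , S , T , θ ⟩} ic (Dec {A₁ = A₁} {f = f} {ss = ss} {ts = ts} {ys = ys} A↭ |ts| |ys| _) =
      invariant-bind {u = app f (map var ys)} {θ = θ} (IsConfig⇒Valid _ ic)
        (selected-∈ (S ++ T) A↭) (selected-⊆ (S ++ T) A↭)
        (++⁺ˡ (S ++ T) (xs⊆ys++xs A₁ (zipAUE ss ys ts)))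
        λ gen → let (σ* , ρ*) = generalises-args ss ys ts |ts| |ys| (gen ∘ ∈-++⁺ˡ ∘ ∈-++⁺ˡ)
                in generalises (≈-cong σ*) (≈-cong ρ*)
    invariant-step {⟨ A , S , T , θ ⟩} _ (Sol {A₁ = A₁} {s = s} {x = x} {t = t} A↭ _ _) =
      invariant-⊆ {θ = θ}
        (⊆-reflexive-↭ (↭-sym (shift (s ≜⟨ x ⟩ t) A₁ (S ++ T))) ∘ selected-⊆ (S ++ T) A↭)
    invariant-step ic (ExpLA1 fe A↭ _) =
      invariant-expand ic A↭ λ ga gb → generalises-respˡ (≈-absL fe star) (generalises-app₂ ga gb)
    invariant-step ic (ExpLA2 fe A↭ _) =
      invariant-expand ic A↭ λ ga gb → generalises-respˡ (≈-absR fe star) (generalises-app₂ gb ga)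
    invariant-step ic (ExpRA1 fe A↭ _) =
      invariant-expand ic A↭ λ ga gb → generalises-respʳ (≈-absL fe star) (generalises-app₂ ga gb)
    invariant-step ic (ExpRA2 fe A↭ _) =
      invariant-expand ic A↭ λ ga gb → generalises-respʳ (≈-absR fe star) (generalises-app₂ gb ga)
    invariant-step {⟨ [] , S , T , θ ⟩} ic (Mer {y = y} S↭) =
      invariant-bind {u = var y} {θ = θ} (IsConfig⇒Valid _ ic)
        (selected-∈ T S↭) (selected-⊆ T S↭) ⊆-refl
        λ gen → gen (here refl)

    invariant-⟹* : ∀ {c c′} → c ⟹* c′ → Invariant (allAUEs c′) (θ c′) → Invariant (allAUEs c) (θ c)
    invariant-⟹* done                   inv = inv
    invariant-⟹* (step (ic , _ , r) d) inv = invariant-step ic r (invariant-⟹* d inv)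

    invariant⇒generalises : ∀ {c e} → IsConfig c → Invariant (allAUEs c) (θ c) → e ∈ allAUEs c →
                            Generalises (θₙ (lbl e)) (lhs e) (rhs e)
    invariant⇒generalises {c} {e} ic (δ , θₙ≗ , gen) e∈ =
      subst (λ u → Generalises u (lhs e) (rhs e))
        (sym (trans (θₙ≗ (lbl e)) (cong (_[ δ ]) (IsConfig⇒θ-fixes-labels c ic (∈-map⁺ lbl e∈)))))
        (gen e∈)

    generalises⇒InG : ∀ {u s t} → Generalises u s t → InG u s t
    generalises⇒InG (generalises uσ≈s uρ≈t) = (σₙ , uσ≈s) , (ρₙ , uρ≈t)

  ≡⇒≈ : ∀ {s t} → s ≡ t → s ≈ t
  ≡⇒≈ refl = ≈-refl

  final-invariant : ∀ {W θ} → Valid W → Backward.Invariant (σ W) (ρ W) θ W θ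
  final-invariant vW =
    var , (λ v → sym ([]-identity _)) ,
    λ e∈ → Backward.generalises (≡⇒≈ (σ-lbl vW e∈)) (≡⇒≈ (ρ-lbl vW e∈))

theorem2 : (Sg : Signature) (Ab : AbsTheory Sg) →
    let open AUnif Sg Ab in
    (A₀ S₀ T₀ Sₙ Tₙ : List AUE) (θ₀ θₙ : Subst) →
    IsConfig ⟨ A₀ , S₀ , T₀ , θ₀ ⟩ →
    ⟨ A₀ , S₀ , T₀ , θ₀ ⟩ ⟹* ⟨ [] , Sₙ , Tₙ , θₙ ⟩ →
    Final ⟨ [] , Sₙ , Tₙ , θₙ ⟩ →
    ∀ s x t → (s ≜⟨ x ⟩ t) ∈ A₀ ++ S₀ ++ T₀ →
    InG (θₙ x) s t ×
    ((θₙ x) [ σ (Sₙ ++ Tₙ) ]) ≈ s ×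
    ((θₙ x) [ ρ (Sₙ ++ Tₙ) ]) ≈ t
theorem2 Sg Ab A₀ S₀ T₀ Sₙ Tₙ θ₀ θₙ ic derivation _ s x t s≜t∈ =
  generalises⇒InG gen , lhs-≈ , rhs-≈
  where
    open AUnif Sg Ab
    open Properties Sg Ab
    open Backward (σ (Sₙ ++ Tₙ)) (ρ (Sₙ ++ Tₙ)) θₙ
    gen : Generalises (θₙ x) s t
    gen = invariant⇒generalises ic
            (invariant-⟹* derivation
              (final-invariant (IsConfig⇒Valid _ (⟹*-IsConfig ic derivation))))
            s≜t∈
    open Generalises gen
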